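{- Let $G(V,E)$ be a hypergraph. Then $\chi^c(G)=\lceil \log_2 \chi(G)\rceil$.
   Context: Hypergraphs are finite, and each hyperedge is a subset of $V$ with at least two vertices. A bicoloring of $G$ is a map $X:V\to\{0,1\}$; a hyperedge $e$ is properly bicolored (non-monochromatic) by $X$ if $X$ is not constant on $e$. A bicoloring cover of $G$ is a set $\{X_1,\dots,X_t\}$ of bicolorings such that every hyperedge $e\in E$ is properly bicolored by at least one $X_i$. The bicoloring cover number $\chi^c(G)$ is the minimum size of a bicoloring cover of $G$. The chromatic number $\chi(G)$ is the minimum number of colors in a vertex coloring of $G$ under which no hyperedge is monochromatic. -}

module Defs where

open import Data.Nat using (ℕ; _≤_)
open import Data.Fin using (Fin)
open import Data.Fin.Subset using (Subset; _∈_; ∣_∣)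
open import Data.Bool using (Bool)
open import Data.List using (List)
open import Data.List.Relation.Unary.All using (All)
open import Data.List.Membership.Propositional renaming (_∈_ to _∈ₗ_)
open import Data.Product using (Σ; _×_; ∃)
open import Relation.Binary.PropositionalEquality using (_≢_)

record Hypergraph : Set where
  field
    n      : ℕ
    edges  : List (Subset n)
    edges≥2 : All (λ e → 2 ≤ ∣ e ∣) edges

open Hypergraph public

NonMono : ∀ {m} {A : Set} → (Fin m → A) → Subset m → Set
NonMono f e = ∃ λ u → ∃ λ v → u ∈ e × v ∈ e × f u ≢ f v

Bicoloring : Hypergraph → Set
Bicoloring G = Fin (n G) → Bool

IsBicoloringCover : (G : Hypergraph) (t : ℕ) → (Fin t → Bicoloring G) → Set
IsBicoloringCover G t X =
  ∀ e → e ∈ₗ edges G → ∃ λ i → NonMono (X i) e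

HasBicoloringCoverOfSize : Hypergraph → ℕ → Set
HasBicoloringCoverOfSize G t = Σ (Fin t → Bicoloring G) (IsBicoloringCover G t)

IsBicoloringCoverNumber : Hypergraph → ℕ → Set
IsBicoloringCoverNumber G t =
  HasBicoloringCoverOfSize G t × (∀ s → HasBicoloringCoverOfSize G s → t ≤ s)

IsProperColoring : (G : Hypergraph) (k : ℕ) → (Fin (n G) → Fin k) → Set
IsProperColoring G k c = ∀ e → e ∈ₗ edges G → NonMono c e

Colorable : Hypergraph → ℕ → Set
Colorable G k = Σ (Fin (n G) → Fin k) (IsProperColoring G k)

IsChromaticNumber : Hypergraph → ℕ → Set
IsChromaticNumber G k = Colorable G k × (∀ j → Colorable G j → k ≤ j)

module Submission where

-- The whole argument is that a colour in Fin (2 ^ t) is the same thing as a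
-- string of t bits.  Reading off the i-th bit of a proper colouring gives t
-- bicolorings, and since two distinct colours differ in some bit, every
-- hyperedge (non-monochromatic under the colouring) is split by one of them.
-- Conversely, the bit strings assigned to the vertices by a cover of size t
-- form a proper colouring with 2 ^ t colours.  So
--   * G has a bicoloring cover of size t  iff  G is 2 ^ t-colourable,
-- and the theorem follows from monotonicity of colourability in the number of
-- colours, the estimate k ≤ 2 ^ ⌈log₂ k⌉, and ⌈log₂ (2 ^ t)⌉ = t.

open import Defs
open import Data.Nat using (ℕ; zero; suc; _≤_; _<_; _^_; _+_; _*_; ⌈_/2⌉; ⌊_/2⌋; z≤n; s≤s)
open import Data.Nat.Properties
  using (≤-antisym; ⌊n/2⌋+⌈n/2⌉≡n; ⌊n/2⌋≤⌈n/2⌉; +-monoˡ-≤; *-monoʳ-≤; *-suc; +-identityʳ; module ≤-Reasoning)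
open import Data.Nat.Logarithm using (⌈log₂_⌉; ⌈log₂⌉-mono-≤; ⌈log₂2^n⌉≡n)
open import Data.Nat.Logarithm.Core using (⌈log2⌉)
open import Data.Nat.Induction using (<-wellFounded)
open import Induction.WellFounded using (Acc; acc)
open import Data.Fin using (Fin; zero; suc; inject≤; combine; funToFin; finToFun)
open import Data.Fin.Properties
  using (2↔Bool; finToFun-funToFin; funToFin-finToFin; inject≤-injective; ¬∀⟶∃¬)
open import Data.Bool using (Bool) renaming (_≟_ to _≟ᵇ_)
open import Data.Product using (_,_; ∃)
open import Function using (_∘_; Inverse)
open import Relation.Binary.PropositionalEquality
  using (_≡_; _≢_; refl; sym; trans; cong; cong₂; module ≡-Reasoning)

nonMono-factor : ∀ {m} {A B : Set} {h : Fin m → B} {c : Fin m → A} (g : A → B) →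
  (∀ u → h u ≡ g (c u)) → ∀ {e} → NonMono h e → NonMono c e
nonMono-factor g h≗g∘c (u , v , u∈e , v∈e , hu≢hv) =
  u , v , u∈e , v∈e , λ cu≡cv → hu≢hv (trans (h≗g∘c u) (trans (cong g cu≡cv) (sym (h≗g∘c v))))

nonMono-inject : ∀ {m} {A B : Set} {c : Fin m → A} (f : A → B) →
  (∀ {x y} → f x ≡ f y → x ≡ y) → ∀ {e} → NonMono c e → NonMono (f ∘ c) e
nonMono-inject f f-inj (u , v , u∈e , v∈e , cu≢cv) = u , v , u∈e , v∈e , cu≢cv ∘ f-inj

colorable-mono : ∀ G {k k′} → k ≤ k′ → Colorable G k → Colorable G k′
colorable-mono G k≤k′ (c , proper) =
  (λ v → inject≤ (c v) k≤k′) ,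
  λ e e∈G → nonMono-inject (λ x → inject≤ x k≤k′) (inject≤-injective k≤k′ k≤k′ _ _) (proper e e∈G)

module 2↔Bool = Inverse 2↔Bool

bit : ∀ {t} → Fin (2 ^ t) → Fin t → Bool
bit x i = 2↔Bool.to (finToFun x i)

fromBits : ∀ {t} → (Fin t → Bool) → Fin (2 ^ t)
fromBits f = funToFin (2↔Bool.from ∘ f)

bit-fromBits : ∀ {t} (f : Fin t → Bool) i → bit (fromBits f) i ≡ f i
bit-fromBits f i = begin
  2↔Bool.to (finToFun (funToFin (2↔Bool.from ∘ f)) i)
    ≡⟨ cong 2↔Bool.to (finToFun-funToFin (2↔Bool.from ∘ f) i) ⟩
  2↔Bool.to (2↔Bool.from (f i))
    ≡⟨ 2↔Bool.strictlyInverseˡ (f i) ⟩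
  f i ∎
  where open ≡-Reasoning

-- funToFin only depends on the values of its argument (no extensionality).
funToFin-cong : ∀ {m k} {f g : Fin m → Fin k} → (∀ i → f i ≡ g i) → funToFin f ≡ funToFin g
funToFin-cong {zero}  f≗g = refl
funToFin-cong {suc m} f≗g = cong₂ combine (f≗g zero) (funToFin-cong (f≗g ∘ suc))

bit-injective : ∀ {t} {x y : Fin (2 ^ t)} → (∀ i → bit x i ≡ bit y i) → x ≡ y
bit-injective {t} {x} {y} same = begin
  x                            ≡⟨ sym (funToFin-finToFin {t} {2} x) ⟩
  funToFin (finToFun {2} {t} x) ≡⟨ funToFin-cong digit≗ ⟩
  funToFin (finToFun {2} {t} y) ≡⟨ funToFin-finToFin {t} {2} y ⟩
  y                            ∎
  where
  open ≡-Reasoning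
  digit≗ : ∀ i → finToFun {2} {t} x i ≡ finToFun y i
  digit≗ i = trans (sym (2↔Bool.strictlyInverseʳ _))
               (trans (cong 2↔Bool.from (same i)) (2↔Bool.strictlyInverseʳ _))

bit-separates : ∀ {t} {x y : Fin (2 ^ t)} → x ≢ y → ∃ λ i → bit x i ≢ bit y i
bit-separates {t} {x} {y} x≢y =
  ¬∀⟶∃¬ t (λ i → bit x i ≡ bit y i) (λ i → bit x i ≟ᵇ bit y i) (x≢y ∘ bit-injective)

cover⇒colorable : ∀ G t → HasBicoloringCoverOfSize G t → Colorable G (2 ^ t)
cover⇒colorable G t (X , cover) = colour , proper
  where
  colour : Fin (n G) → Fin (2 ^ t)
  colour v = fromBits (λ i → X i v)

  proper : IsProperColoring G (2 ^ t) colour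
  proper e e∈G with cover e e∈G
  ... | i , split = nonMono-factor (λ x → bit x i) (λ v → sym (bit-fromBits (λ j → X j v) i)) split

colorable⇒cover : ∀ G t → Colorable G (2 ^ t) → HasBicoloringCoverOfSize G t
colorable⇒cover G t (c , proper) = X , cover
  where
  X : Fin t → Bicoloring G
  X i v = bit (c v) i

  cover : IsBicoloringCover G t X
  cover e e∈G with proper e e∈G
  ... | u , v , u∈e , v∈e , cu≢cv with bit-separates {t} cu≢cv
  ...   | i , bits-differ = i , u , v , u∈e , v∈e , bits-differ

m≤2*⌈m/2⌉ : ∀ m → m ≤ 2 * ⌈ m /2⌉
m≤2*⌈m/2⌉ m = begin
  m                        ≡⟨ sym (⌊n/2⌋+⌈n/2⌉≡n m) ⟩
  ⌊ m /2⌋ + ⌈ m /2⌉        ≤⟨ +-monoˡ-≤ ⌈ m /2⌉ (⌊n/2⌋≤⌈n/2⌉ m) ⟩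
  ⌈ m /2⌉ + ⌈ m /2⌉        ≡⟨ cong (⌈ m /2⌉ +_) (sym (+-identityʳ ⌈ m /2⌉)) ⟩
  2 * ⌈ m /2⌉              ∎
  where open ≤-Reasoning

-- ⌈log₂ n⌉ bits suffice to write down n distinct values, by the recursion
-- ⌈log₂ (m + 2)⌉ = 1 + ⌈log₂ (1 + ⌈m/2⌉)⌉ defining the logarithm.
n≤2^⌈log2⌉n : ∀ n (rec : Acc _<_ n) → n ≤ 2 ^ ⌈log2⌉ n rec
n≤2^⌈log2⌉n zero          _        = z≤n
n≤2^⌈log2⌉n (suc zero)    _        = s≤s z≤n
n≤2^⌈log2⌉n (suc (suc m)) (acc rs) = begin
  2 + m                  ≤⟨ s≤s (s≤s (m≤2*⌈m/2⌉ m)) ⟩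
  2 + 2 * ⌈ m /2⌉        ≡⟨ sym (*-suc 2 ⌈ m /2⌉) ⟩
  2 * suc ⌈ m /2⌉        ≤⟨ *-monoʳ-≤ 2 (n≤2^⌈log2⌉n (suc ⌈ m /2⌉) _) ⟩
  2 * 2 ^ ⌈log2⌉ (suc ⌈ m /2⌉) _ ∎
  where open ≤-Reasoning

n≤2^⌈log₂n⌉ : ∀ n → n ≤ 2 ^ ⌈log₂ n ⌉
n≤2^⌈log₂n⌉ n = n≤2^⌈log2⌉n n (<-wellFounded n)

theorem1 : (G : Hypergraph) (k t : ℕ) → IsChromaticNumber G k →
    IsBicoloringCoverNumber G t → t ≡ ⌈log₂ k ⌉
theorem1 G k t (k-colorable , k-minimal) (t-cover , t-minimal) = ≤-antisym t≤log log≤t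
  where
  t≤log : t ≤ ⌈log₂ k ⌉
  t≤log = t-minimal ⌈log₂ k ⌉
            (colorable⇒cover G ⌈log₂ k ⌉ (colorable-mono G (n≤2^⌈log₂n⌉ k) k-colorable))

  log≤t : ⌈log₂ k ⌉ ≤ t
  log≤t = begin
    ⌈log₂ k ⌉       ≤⟨ ⌈log₂⌉-mono-≤ (k-minimal (2 ^ t) (cover⇒colorable G t t-cover)) ⟩
    ⌈log₂ (2 ^ t) ⌉ ≡⟨ ⌈log₂2^n⌉≡n t ⟩
    t               ∎
    where open ≤-Reasoning
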